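{- Let $G=(V,E)$ be an undirected graph whose vertices have distinct IDs, and construct the weighted undirected graph $G_S=(V_S,E_S)$ as follows. For each $v\in V$, $V_S$ contains three vertices $v_1,v_2,v_3$, joined by a triangle where $\{v_1,v_2\}$ has weight 1 and $\{v_1,v_3\},\{v_2,v_3\}$ have weight 0. For each edge $\{v,u\}\in E$ where $v$ has the smaller ID, $E_S$ contains the edges $\{v_1,u_1\}$ and $\{v_2,u_2\}$ of weight 0 and the edge $\{v_1,u_2\}$ of weight 2. Then the minimum cost of a 2-spanner of $G_S$ equals the size of a minimum vertex cover of $G$.
   Context: For a weighted undirected graph $G_S=(V_S,E_S)$ with non-negative weights, a 2-spanner is a subgraph $H\subseteq E_S$ such that for every edge $\{x,y\}\in E_S$ there is a path with at most 2 edges between $x$ and $y$ in $H$; its cost is $w(H)=\sum_{e\in H}w(e)$. A vertex cover of $G$ is a set $C\subseteq V$ containing at least one endpoint of every edge. -}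

module Defs where

open import Data.Nat using (ℕ; zero; suc; _+_; _≤_)
open import Data.Bool using (Bool; true; false; if_then_else_; _∧_)
open import Data.Fin using (Fin; _<_; _<?_)
open import Data.Fin.Subset using (Subset; _∈_; ∣_∣)
open import Data.Product using (_×_; _,_; Σ; ∃; ∃-syntax)
open import Data.Sum using (_⊎_)
open import Data.List using (List; []; _∷_; _++_; concatMap; length; map; allFin)
open import Data.Nat.ListAction using (sum)
open import Data.List.Base using (lookup)
open import Relation.Binary.PropositionalEquality using (_≡_)
open import Relation.Nullary.Decidable using (⌊_⌋)
import Data.Vec as Vec

-- The input graph G = (V, E): vertices are Fin n (the vertex IDs; the
-- order on Fin n is the order on IDs), edges given by a Bool-valued
-- adjacency relation, required to be symmetric and loop-free.

Adj : ℕ → Set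
Adj n = Fin n → Fin n → Bool

Symmetric : ∀ {n} → Adj n → Set
Symmetric {n} E = (u v : Fin n) → E u v ≡ E v u

Loopless : ∀ {n} → Adj n → Set
Loopless {n} E = (v : Fin n) → E v v ≡ false

IsVertexCover : ∀ {n} → Adj n → Subset n → Set
IsVertexCover {n} E C = (u v : Fin n) → E u v ≡ true → u ∈ C ⊎ v ∈ C

IsMinVertexCoverSize : ∀ {n} → Adj n → ℕ → Set
IsMinVertexCoverSize {n} E k =
  (Σ (Subset n) λ C → IsVertexCover E C × ∣ C ∣ ≡ k) ×
  ((C : Subset n) → IsVertexCover E C → k ≤ ∣ C ∣)

-- The weighted graph G_S.  Vertex v_i (i = 1,2,3) is (v , i-1).

VS : ℕ → Set
VS n = Fin n × Fin 3

record WEdge (n : ℕ) : Set where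
  constructor wedge
  field
    end₁ : VS n
    end₂ : VS n
    weight : ℕ
open WEdge public

v₁ v₂ v₃ : ∀ {n} → Fin n → VS n
v₁ v = v , Fin.zero where import Data.Fin as Fin
v₂ v = v , Fin.suc Fin.zero where import Data.Fin as Fin
v₃ v = v , Fin.suc (Fin.suc Fin.zero) where import Data.Fin as Fin

triangle : ∀ {n} → Fin n → List (WEdge n)
triangle v = wedge (v₁ v) (v₂ v) 1 ∷ wedge (v₁ v) (v₃ v) 0 ∷ wedge (v₂ v) (v₃ v) 0 ∷ []

crossEdges : ∀ {n} → Fin n → Fin n → List (WEdge n)
crossEdges v u = wedge (v₁ v) (v₁ u) 0 ∷ wedge (v₂ v) (v₂ u) 0 ∷ wedge (v₁ v) (v₂ u) 2 ∷ []

ES : ∀ {n} → Adj n → List (WEdge n)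
ES {n} E =
  concatMap triangle (allFin n) ++
  concatMap (λ v → concatMap (λ u → if E v u ∧ ⌊ v <? u ⌋ then crossEdges v u else [])
                             (allFin n))
            (allFin n)

mS : ∀ {n} → Adj n → ℕ
mS E = length (ES E)

edgeS : ∀ {n} (E : Adj n) → Fin (mS E) → WEdge n
edgeS E i = lookup (ES E) i

Joins : ∀ {n} → WEdge n → VS n → VS n → Set
Joins e x y = (end₁ e ≡ x × end₂ e ≡ y) ⊎ (end₁ e ≡ y × end₂ e ≡ x)

-- a subgraph H ⊆ E_S is a subset of the edge indices
-- x and y are joined by an edge of H
InH : ∀ {n} (E : Adj n) → Subset (mS E) → VS n → VS n → Set
InH E H x y = ∃[ i ] (i ∈ H × Joins (edgeS E i) x y)

Is2Spanner : ∀ {n} (E : Adj n) → Subset (mS E) → Set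
Is2Spanner E H = (j : Fin (mS E)) →
  let x = end₁ (edgeS E j) ; y = end₂ (edgeS E j) in
  InH E H x y ⊎ (∃[ z ] (InH E H x z × InH E H z y))

cost : ∀ {n} (E : Adj n) → Subset (mS E) → ℕ
cost E H = sum (map (λ i → if Vec.lookup H i then weight (edgeS E i) else 0) (allFin (mS E)))

IsMin2SpannerCost : ∀ {n} → Adj n → ℕ → Set
IsMin2SpannerCost E k =
  (Σ (Subset (mS E)) λ H → Is2Spanner E H × cost E H ≡ k) ×
  ((H : Subset (mS E)) → Is2Spanner E H → k ≤ cost E H)

-- A vertex cover C of G gives a 2-spanner of cost ∣C∣: keep every weight-0 edge and the
-- weight-1 edge v₁v₂ for each v ∈ C; the weight-2 edge a₁b₂ of an edge {a,b} is then bridged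
-- through a₂ (if a ∈ C) or through b₁ (if b ∈ C).  Conversely, weight-0 edges either stay on one
-- level or pass through some v₃, so two of them never lead from a₁ to b₂ with a ≠ b.  Hence in a
-- 2-spanner H the replacement of a₁b₂ uses a positive-weight edge at a or at b, and the
-- G-endpoints of the positive-weight edges of H form a vertex cover.  It has size at most w(H),
-- because the only weight-1 edges v₁v₂ have a single G-endpoint.
module Submission where

open import Defs
open import Data.Bool using (Bool; true; false; if_then_else_; _∧_)
import Data.Bool.Properties as Bool
open import Data.Empty using (⊥-elim)
open import Data.Fin using (Fin; _<?_) renaming (_<_ to _<ᶠ_)
import Data.Fin.Properties as Fin
open import Data.Fin.Subset using (Subset; _∈_; ∣_∣; ⁅_⁆; _∪_; ⋃; ⊤) renaming (⊥ to ∅)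
open import Data.Fin.Subset.Properties using (∣⊥∣≡0; ∣⁅x⁆∣≡1; x∈⁅x⁆; x∈p∪q⁺; ∈⊤; anySubset?; _∈?_)
open import Data.List using (List; []; _∷_; _++_; concatMap; map; allFin; tabulate)
open import Data.List.Base using (lookup)
import Data.List.Properties as List
open import Data.List.Membership.Propositional using (lose) renaming (_∈_ to _∈ᴸ_)
open import Data.List.Membership.Propositional.Properties
  using (∈-++⁺ˡ; ∈-++⁺ʳ; ∈-allFin; ∈-lookup; ∈-concatMap⁺)
open import Data.List.Relation.Unary.All as All using (All; []; _∷_)
open import Data.List.Relation.Unary.All.Properties using (++⁺; concat⁺; map⁺; tabulate⁺)
open import Data.List.Relation.Unary.Any using (here; there; index)
open import Data.List.Relation.Unary.Any.Properties using (lookup-index)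
open import Data.Nat using (ℕ; zero; suc; _+_; _≤_; _<_; z≤n; s≤s)
import Data.Nat as ℕ
open import Data.Nat.Properties
  using (≤-refl; ≤-reflexive; ≤-trans; ≤-pred; n≤1+n; +-suc; +-identityʳ; +-mono-≤; +-monoʳ-≤; ≮⇒≥)
open import Data.Nat.ListAction using (sum)
open import Data.Nat.ListAction.Properties using (sum-++)
open import Data.Product using (_×_; _,_; proj₁; ∃; ∃-syntax)
import Data.Product as Product
open import Data.Sum using (_⊎_; inj₁; inj₂)
import Data.Sum as Sum
import Data.Vec as Vec
open import Data.Vec.Properties using (lookup∘tabulate; lookup⇒[]=; []=⇒lookup)
open import Function using (_∘_)
open import Relation.Binary.Definitions using (tri<; tri≈; tri>)
open import Relation.Binary.PropositionalEquality
open import Relation.Nullary using (yes; no; ¬_; contradiction)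
open import Relation.Nullary.Decidable using (⌊_⌋; isYes≗does; dec-true; _×-dec_; _⊎-dec_; _→-dec_)
open import Relation.Unary using (Decidable)

sum-concatMap : ∀ {A B : Set} (g : B → ℕ) (f : A → List B) (xs : List A) →
  sum (map g (concatMap f xs)) ≡ sum (map (λ x → sum (map g (f x))) xs)
sum-concatMap g f [] = refl
sum-concatMap g f (x ∷ xs) = begin
  sum (map g (f x ++ concatMap f xs))               ≡⟨ cong sum (List.map-++ g (f x) _) ⟩
  sum (map g (f x) ++ map g (concatMap f xs))       ≡⟨ sum-++ (map g (f x)) _ ⟩
  sum (map g (f x)) + sum (map g (concatMap f xs))  ≡⟨ cong (sum (map g (f x)) +_) (sum-concatMap g f xs) ⟩
  sum (map g (f x)) + sum (map (λ y → sum (map g (f y))) xs) ∎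
  where open ≡-Reasoning

sum-map-zero : ∀ {A : Set} {f : A → ℕ} → (∀ x → f x ≡ 0) → (xs : List A) → sum (map f xs) ≡ 0
sum-map-zero f≡0 [] = refl
sum-map-zero f≡0 (x ∷ xs) = cong₂ _+_ (f≡0 x) (sum-map-zero f≡0 xs)

∣p∪q∣≤∣p∣+∣q∣ : ∀ {n} (p q : Subset n) → ∣ p ∪ q ∣ ≤ ∣ p ∣ + ∣ q ∣
∣p∪q∣≤∣p∣+∣q∣ Vec.[] Vec.[] = z≤n
∣p∪q∣≤∣p∣+∣q∣ (true Vec.∷ p) (true Vec.∷ q) =
  s≤s (≤-trans (∣p∪q∣≤∣p∣+∣q∣ p q) (+-monoʳ-≤ ∣ p ∣ (n≤1+n ∣ q ∣)))
∣p∪q∣≤∣p∣+∣q∣ (true Vec.∷ p) (false Vec.∷ q) = s≤s (∣p∪q∣≤∣p∣+∣q∣ p q)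
∣p∪q∣≤∣p∣+∣q∣ (false Vec.∷ p) (true Vec.∷ q) =
  ≤-trans (s≤s (∣p∪q∣≤∣p∣+∣q∣ p q)) (≤-reflexive (sym (+-suc ∣ p ∣ ∣ q ∣)))
∣p∪q∣≤∣p∣+∣q∣ (false Vec.∷ p) (false Vec.∷ q) = ∣p∪q∣≤∣p∣+∣q∣ p q

module _ {n : ℕ} {A : Set} (f : A → Subset n) where

  x∈⋃map⁺ : ∀ {y x xs} → y ∈ᴸ xs → x ∈ f y → x ∈ ⋃ (map f xs)
  x∈⋃map⁺ (here refl) x∈fy = x∈p∪q⁺ (inj₁ x∈fy)
  x∈⋃map⁺ (there y∈xs) x∈fy = x∈p∪q⁺ (inj₂ (x∈⋃map⁺ y∈xs x∈fy))

  ∣⋃map∣≤sum : {g : A → ℕ} → (∀ x → ∣ f x ∣ ≤ g x) → (xs : List A) → ∣ ⋃ (map f xs) ∣ ≤ sum (map g xs)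
  ∣⋃map∣≤sum f≤g [] = ≤-reflexive (∣⊥∣≡0 n)
  ∣⋃map∣≤sum f≤g (x ∷ xs) = ≤-trans (∣p∪q∣≤∣p∣+∣q∣ (f x) _) (+-mono-≤ (f≤g x) (∣⋃map∣≤sum f≤g xs))

∣p∣≡sum-indicator : ∀ {n} (p : Subset n) → ∣ p ∣ ≡ sum (tabulate (λ i → if Vec.lookup p i then 1 else 0))
∣p∣≡sum-indicator Vec.[] = refl
∣p∣≡sum-indicator (true Vec.∷ p) = cong suc (∣p∣≡sum-indicator p)
∣p∣≡sum-indicator (false Vec.∷ p) = ∣p∣≡sum-indicator p

module _ {n : ℕ} {P : Subset n → Set} (P? : Decidable P) (f : Subset n → ℕ) where

  ∃-minimal : ∃ P → ∃[ C ] P C × (∀ D → P D → f C ≤ f D)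
  ∃-minimal (C , pC) = descend (suc (f C)) C pC ≤-refl
    where
    descend : ∀ bound C → P C → f C < bound → ∃[ C ] P C × (∀ D → P D → f C ≤ f D)
    descend (suc bound) C pC fC<bound with anySubset? (λ D → P? D ×-dec (f D ℕ.<? f C))
    ... | yes (D , pD , fD<fC) = descend bound D pD (≤-trans fD<fC (≤-pred fC<bound))
    ... | no ∄smaller = C , pC , λ D pD → ≮⇒≥ (λ fD<fC → ∄smaller (D , pD , fD<fC))

isVertexCover? : ∀ {n} (E : Adj n) → Decidable (IsVertexCover E)
isVertexCover? E C =
  Fin.all? λ u → Fin.all? λ v → (E u v Bool.≟ true) →-dec ((u ∈? C) ⊎-dec (v ∈? C))

minimumVertexCover : ∀ {n} (E : Adj n) →
  ∃[ C ] IsVertexCover E C × (∀ D → IsVertexCover E D → ∣ C ∣ ≤ ∣ D ∣)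
minimumVertexCover E = ∃-minimal (isVertexCover? E) ∣_∣ (⊤ , λ _ _ _ → inj₁ ∈⊤)

data EdgeShape {n} (E : Adj n) : WEdge n → Set where
  tri₁₂   : ∀ v → EdgeShape E (wedge (v₁ v) (v₂ v) 1)
  tri₁₃   : ∀ v → EdgeShape E (wedge (v₁ v) (v₃ v) 0)
  tri₂₃   : ∀ v → EdgeShape E (wedge (v₂ v) (v₃ v) 0)
  cross₁₁ : ∀ a b → E a b ≡ true → a <ᶠ b → EdgeShape E (wedge (v₁ a) (v₁ b) 0)
  cross₂₂ : ∀ a b → E a b ≡ true → a <ᶠ b → EdgeShape E (wedge (v₂ a) (v₂ b) 0)
  cross₁₂ : ∀ a b → E a b ≡ true → a <ᶠ b → EdgeShape E (wedge (v₁ a) (v₂ b) 2)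

module _ {n : ℕ} (E : Adj n) where

  crossBlock : Fin n → Fin n → List (WEdge n)
  crossBlock a b = if E a b ∧ ⌊ a <? b ⌋ then crossEdges a b else []

  crossBlock-shapes : ∀ a b → All (EdgeShape E) (crossBlock a b)
  crossBlock-shapes a b with E a b in eab | a <? b
  ... | true  | yes a<b = cross₁₁ a b eab a<b ∷ cross₂₂ a b eab a<b ∷ cross₁₂ a b eab a<b ∷ []
  ... | true  | no _    = []
  ... | false | _       = []

  ES-shapes : All (EdgeShape E) (ES E)
  ES-shapes = ++⁺ (concat⁺ (map⁺ (tabulate⁺ λ v → tri₁₂ v ∷ tri₁₃ v ∷ tri₂₃ v ∷ [])))
                  (concat⁺ (map⁺ (tabulate⁺ λ a → concat⁺ (map⁺ (tabulate⁺ (crossBlock-shapes a))))))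

  edgeS-shape : ∀ i → EdgeShape E (edgeS E i)
  edgeS-shape i = All.lookup ES-shapes (∈-lookup i)

  triangle⊆ES : ∀ v {e} → e ∈ᴸ triangle v → e ∈ᴸ ES E
  triangle⊆ES v e∈ = ∈-++⁺ˡ (∈-concatMap⁺ triangle (lose (∈-allFin v) e∈))

  crossEdges⊆ES : ∀ {a b e} → E a b ≡ true → a <ᶠ b → e ∈ᴸ crossEdges a b → e ∈ᴸ ES E
  crossEdges⊆ES {a} {b} {e} eab a<b e∈ =
    ∈-++⁺ʳ (concatMap triangle (allFin n))
      (∈-concatMap⁺ _ (lose (∈-allFin a) (∈-concatMap⁺ _ (lose (∈-allFin b) e∈crossBlock))))
    where
    e∈crossBlock : e ∈ᴸ crossBlock a b
    e∈crossBlock = subst (λ c → e ∈ᴸ (if c then crossEdges a b else []))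
                         (sym (cong₂ _∧_ eab (trans (isYes≗does (a <? b)) (dec-true (a <? b) a<b)))) e∈

  Spans : Subset (mS E) → VS n → VS n → Set
  Spans H x y = InH E H x y ⊎ ∃[ z ] (InH E H x z × InH E H z y)

  spans-∈ES : ∀ {H e} → Is2Spanner E H → e ∈ᴸ ES E → Spans H (end₁ e) (end₂ e)
  spans-∈ES {H} spanner e∈ =
    subst (λ e → Spans H (end₁ e) (end₂ e)) (sym (lookup-index e∈)) (spanner (index e∈))

  select : (WEdge n → Bool) → Subset (mS E)
  select keep = Vec.tabulate (keep ∘ edgeS E)

  InH-select : ∀ keep {e x y} → e ∈ᴸ ES E → keep e ≡ true → Joins e x y → InH E (select keep) x y
  InH-select keep e∈ kept J =
    index e∈ , lookup⇒[]= (index e∈) _ (trans (lookup∘tabulate (keep ∘ edgeS E) (index e∈)) kept′)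
             , subst (λ e → Joins e _ _) (lookup-index e∈) J
    where kept′ = trans (cong keep (sym (lookup-index e∈))) kept

  cost-select : ∀ keep → cost E (select keep) ≡ sum (map (λ e → if keep e then weight e else 0) (ES E))
  cost-select keep = cong sum (begin
    map (λ i → if Vec.lookup (select keep) i then weight (edgeS E i) else 0) (allFin (mS E))
      ≡⟨ List.map-cong (λ i → cong (λ b → if b then weight (edgeS E i) else 0)
                                   (lookup∘tabulate (keep ∘ edgeS E) i)) (allFin (mS E)) ⟩
    map (w ∘ lookup (ES E)) (allFin (mS E))  ≡⟨ List.map-tabulate (λ i → i) (w ∘ lookup (ES E)) ⟩
    tabulate (w ∘ lookup (ES E))             ≡⟨ List.map-tabulate (lookup (ES E)) w ⟨
    map w (tabulate (lookup (ES E)))         ≡⟨ cong (map w) (List.tabulate-lookup (ES E)) ⟩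
    map w (ES E)                             ∎)
    where
    open ≡-Reasoning
    w : WEdge n → ℕ
    w e = if keep e then weight e else 0

module CoverToSpanner {n : ℕ} (E : Adj n) (C : Subset n) (C-cover : IsVertexCover E C) where

  kept : WEdge n → Bool
  kept (wedge _ _ zero) = true
  kept (wedge (v , _) _ (suc zero)) = Vec.lookup C v
  kept (wedge _ _ (suc (suc _))) = false

  spanner : Subset (mS E)
  spanner = select E kept

  zeroEdge : ∀ {e x y} → e ∈ᴸ ES E → weight e ≡ 0 → Joins e x y → InH E spanner x y
  zeroEdge {wedge _ _ zero} e∈ refl = InH-select E kept e∈ refl

  triangleEdge : ∀ {v} → v ∈ C → InH E spanner (v₁ v) (v₂ v)
  triangleEdge {v} v∈C = InH-select E kept (triangle⊆ES E v (here refl)) ([]=⇒lookup v∈C) (inj₁ (refl , refl))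

  spans : ∀ {e} → e ∈ᴸ ES E → EdgeShape E e → Spans E spanner (end₁ e) (end₂ e)
  spans e∈ (tri₁₂ v) = inj₂ (v₃ v , zeroEdge v₁v₃∈ refl (inj₁ (refl , refl))
                                  , zeroEdge v₂v₃∈ refl (inj₂ (refl , refl)))
    where
    v₁v₃∈ = triangle⊆ES E v (there (here refl))
    v₂v₃∈ = triangle⊆ES E v (there (there (here refl)))
  spans e∈ (tri₁₃ v) = inj₁ (zeroEdge e∈ refl (inj₁ (refl , refl)))
  spans e∈ (tri₂₃ v) = inj₁ (zeroEdge e∈ refl (inj₁ (refl , refl)))
  spans e∈ (cross₁₁ a b _ _) = inj₁ (zeroEdge e∈ refl (inj₁ (refl , refl)))
  spans e∈ (cross₂₂ a b _ _) = inj₁ (zeroEdge e∈ refl (inj₁ (refl , refl)))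
  spans e∈ (cross₁₂ a b eab a<b) with C-cover a b eab
  ... | inj₁ a∈C = inj₂ (v₂ a , triangleEdge a∈C , zeroEdge v₂v₂∈ refl (inj₁ (refl , refl)))
    where v₂v₂∈ = crossEdges⊆ES E eab a<b (there (here refl))
  ... | inj₂ b∈C = inj₂ (v₁ b , zeroEdge v₁v₁∈ refl (inj₁ (refl , refl)) , triangleEdge b∈C)
    where v₁v₁∈ = crossEdges⊆ES E eab a<b (here refl)

  isSpanner : Is2Spanner E spanner
  isSpanner j = spans (∈-lookup j) (edgeS-shape E j)

  private
    keptWeight : WEdge n → ℕ
    keptWeight e = if kept e then weight e else 0

    crossEdges-cost : ∀ b a c → sum (map keptWeight (if b then crossEdges a c else [])) ≡ 0
    crossEdges-cost true a c = refl
    crossEdges-cost false a c = refl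

    crossBlocks-cost : sum (map keptWeight (concatMap (λ a → concatMap (crossBlock E a) (allFin n)) (allFin n))) ≡ 0
    crossBlocks-cost = trans (sum-concatMap keptWeight _ (allFin n)) (sum-map-zero row (allFin n))
      where
      row : ∀ a → sum (map keptWeight (concatMap (crossBlock E a) (allFin n))) ≡ 0
      row a = trans (sum-concatMap keptWeight _ (allFin n))
                    (sum-map-zero (λ c → crossEdges-cost (E a c ∧ ⌊ a <? c ⌋) a c) (allFin n))

    indicator : Fin n → ℕ
    indicator v = if Vec.lookup C v then 1 else 0

    triangles-cost : sum (map keptWeight (concatMap triangle (allFin n))) ≡ ∣ C ∣
    triangles-cost = begin
      sum (map keptWeight (concatMap triangle (allFin n)))
        ≡⟨ sum-concatMap keptWeight triangle (allFin n) ⟩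
      sum (map (λ v → sum (map keptWeight (triangle v))) (allFin n))
        ≡⟨ cong sum (List.map-cong (λ v → +-identityʳ (indicator v)) (allFin n)) ⟩
      sum (map indicator (allFin n))  ≡⟨ cong sum (List.map-tabulate (λ v → v) indicator) ⟩
      sum (tabulate indicator)        ≡⟨ ∣p∣≡sum-indicator C ⟨
      ∣ C ∣                           ∎
      where open ≡-Reasoning

  cost≡∣C∣ : cost E spanner ≡ ∣ C ∣
  cost≡∣C∣ = begin
    cost E spanner                                        ≡⟨ cost-select E kept ⟩
    sum (map keptWeight (triangles ++ crossBlocks))       ≡⟨ cong sum (List.map-++ keptWeight triangles _) ⟩
    sum (map keptWeight triangles ++ map keptWeight crossBlocks)
                                                          ≡⟨ sum-++ (map keptWeight triangles) _ ⟩
    sum (map keptWeight triangles) + sum (map keptWeight crossBlocks)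
                                                          ≡⟨ cong₂ _+_ triangles-cost crossBlocks-cost ⟩
    ∣ C ∣ + 0                                             ≡⟨ +-identityʳ ∣ C ∣ ⟩
    ∣ C ∣                                                 ∎
    where
    open ≡-Reasoning
    triangles = concatMap triangle (allFin n)
    crossBlocks = concatMap (λ a → concatMap (crossBlock E a) (allFin n)) (allFin n)

data ZeroStep {n : ℕ} : VS n → VS n → Set where
  up₃   : ∀ {v i} → ZeroStep (v , i) (v₃ v)
  down₃ : ∀ {v i} → ZeroStep (v₃ v) (v , i)
  level : ∀ {u v i} → ZeroStep (u , i) (v , i)

zeroStep-sym : ∀ {n} {x y : VS n} → ZeroStep x y → ZeroStep y x
zeroStep-sym up₃ = down₃
zeroStep-sym down₃ = up₃
zeroStep-sym level = level

¬zeroStep-v₁-v₂ : ∀ {n} {a b : Fin n} → ¬ ZeroStep (v₁ a) (v₂ b)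
¬zeroStep-v₁-v₂ ()

zeroStep²-v₁-v₂ : ∀ {n} {a b : Fin n} {z : VS n} → ZeroStep (v₁ a) z → ZeroStep z (v₂ b) → a ≡ b
zeroStep²-v₁-v₂ up₃ down₃ = refl

module _ {n : ℕ} {E : Adj n} where

  support : ∀ {e} → EdgeShape E e → Subset n
  support (tri₁₂ v) = ⁅ v ⁆
  support (cross₁₂ a b _ _) = ⁅ a ⁆ ∪ ⁅ b ⁆
  support _ = ∅

  ∣support∣≤weight : ∀ {e} (s : EdgeShape E e) → ∣ support s ∣ ≤ weight e
  ∣support∣≤weight (tri₁₂ v) = ≤-reflexive (∣⁅x⁆∣≡1 v)
  ∣support∣≤weight (tri₁₃ v) = ≤-reflexive (∣⊥∣≡0 n)
  ∣support∣≤weight (tri₂₃ v) = ≤-reflexive (∣⊥∣≡0 n)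
  ∣support∣≤weight (cross₁₁ a b _ _) = ≤-reflexive (∣⊥∣≡0 n)
  ∣support∣≤weight (cross₂₂ a b _ _) = ≤-reflexive (∣⊥∣≡0 n)
  ∣support∣≤weight (cross₁₂ a b _ _) =
    ≤-trans (∣p∪q∣≤∣p∣+∣q∣ ⁅ a ⁆ ⁅ b ⁆) (≤-reflexive (cong₂ _+_ (∣⁅x⁆∣≡1 a) (∣⁅x⁆∣≡1 b)))

  InSupport : ∀ {e} → EdgeShape E e → VS n → VS n → Set
  InSupport s x y = proj₁ x ∈ support s × proj₁ y ∈ support s

  inSupport-or-zeroStep : ∀ {e} (s : EdgeShape E e) → InSupport s (end₁ e) (end₂ e) ⊎ ZeroStep (end₁ e) (end₂ e)
  inSupport-or-zeroStep (tri₁₂ v) = inj₁ (x∈⁅x⁆ v , x∈⁅x⁆ v)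
  inSupport-or-zeroStep (tri₁₃ v) = inj₂ up₃
  inSupport-or-zeroStep (tri₂₃ v) = inj₂ up₃
  inSupport-or-zeroStep (cross₁₁ a b _ _) = inj₂ level
  inSupport-or-zeroStep (cross₂₂ a b _ _) = inj₂ level
  inSupport-or-zeroStep (cross₁₂ a b _ _) = inj₁ (x∈p∪q⁺ (inj₁ (x∈⁅x⁆ a)) , x∈p∪q⁺ (inj₂ (x∈⁅x⁆ b)))

  joins-inSupport-or-zeroStep : ∀ {e x y} (s : EdgeShape E e) → Joins e x y → InSupport s x y ⊎ ZeroStep x y
  joins-inSupport-or-zeroStep s (inj₁ (refl , refl)) = inSupport-or-zeroStep s
  joins-inSupport-or-zeroStep s (inj₂ (refl , refl)) = Sum.map Product.swap zeroStep-sym (inSupport-or-zeroStep s)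

module SpannerToCover {n : ℕ} (E : Adj n) (H : Subset (mS E)) where

  chosen : Fin (mS E) → Subset n
  chosen i = if Vec.lookup H i then support (edgeS-shape E i) else ∅

  cover : Subset n
  cover = ⋃ (map chosen (allFin (mS E)))

  ∣cover∣≤cost : ∣ cover ∣ ≤ cost E H
  ∣cover∣≤cost = ∣⋃map∣≤sum chosen ∣chosen∣≤weight (allFin (mS E))
    where
    ∣chosen∣≤weight : ∀ i → ∣ chosen i ∣ ≤ (if Vec.lookup H i then weight (edgeS E i) else 0)
    ∣chosen∣≤weight i with Vec.lookup H i
    ... | true  = ∣support∣≤weight (edgeS-shape E i)
    ... | false = ≤-reflexive (∣⊥∣≡0 n)

  InCover : VS n → VS n → Set
  InCover x y = proj₁ x ∈ cover × proj₁ y ∈ cover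

  inCover-or-zeroStep : ∀ {x y} → InH E H x y → InCover x y ⊎ ZeroStep x y
  inCover-or-zeroStep (i , i∈H , J) =
    Sum.map₁ (Product.map inCover inCover) (joins-inSupport-or-zeroStep (edgeS-shape E i) J)
    where
    inCover : ∀ {v} → v ∈ support (edgeS-shape E i) → v ∈ cover
    inCover v∈ = x∈⋃map⁺ chosen (∈-allFin i)
      (subst (λ b → _ ∈ (if b then support (edgeS-shape E i) else ∅)) (sym ([]=⇒lookup i∈H)) v∈)

  module _ (spanner : Is2Spanner E H) where

    forward-edge-covered : ∀ {a b} → E a b ≡ true → a <ᶠ b → a ∈ cover ⊎ b ∈ cover
    forward-edge-covered {a} {b} eab a<b with spans-∈ES E spanner (crossEdges⊆ES E eab a<b (there (there (here refl))))
    ... | inj₁ edge with inCover-or-zeroStep edge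
    ...   | inj₁ (a∈ , _) = inj₁ a∈
    ...   | inj₂ step = ⊥-elim (¬zeroStep-v₁-v₂ step)
    forward-edge-covered eab a<b | inj₂ (z , first , second) with inCover-or-zeroStep first | inCover-or-zeroStep second
    ... | inj₁ (a∈ , _) | _             = inj₁ a∈
    ... | inj₂ _        | inj₁ (_ , b∈) = inj₂ b∈
    ... | inj₂ step₁    | inj₂ step₂    = ⊥-elim (Fin.<⇒≢ a<b (zeroStep²-v₁-v₂ step₁ step₂))

    isVertexCover : Symmetric E → Loopless E → IsVertexCover E cover
    isVertexCover symE loopless u v euv with Fin.<-cmp u v
    ... | tri< u<v _ _ = forward-edge-covered euv u<v
    ... | tri≈ _ refl _ = contradiction (trans (sym euv) (loopless u)) λ ()
    ... | tri> _ _ v<u = Sum.swap (forward-edge-covered (trans (symE v u) euv) v<u)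

claim14 : (n : ℕ) (E : Adj n) → Symmetric E → Loopless E →
    ∃[ k ] (IsMin2SpannerCost E k × IsMinVertexCoverSize E k)
claim14 n E symE loopless with minimumVertexCover E
... | C , C-cover , C-minimal =
  ∣ C ∣ , ((spanner , isSpanner , cost≡∣C∣) , spanner-cost≥∣C∣) , ((C , C-cover , refl) , C-minimal)
  where
  open CoverToSpanner E C C-cover
  spanner-cost≥∣C∣ : (H : Subset (mS E)) → Is2Spanner E H → ∣ C ∣ ≤ cost E H
  spanner-cost≥∣C∣ H H-spanner =
    ≤-trans (C-minimal cover (isVertexCover H-spanner symE loopless)) ∣cover∣≤cost
    where open SpannerToCover E H
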